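{- For complex $|x|<1$ write \[ \prod_{n=1}^{\infty} (1+x^n)^4 (1+x^{2n})^2 (1+x^{4n})^4 = \sum_{n=0}^{\infty} \alpha(n) x^n . \] Then $\alpha(n) > 0$ for all $n\in\mathbb{N}_0=\{0,1,2,\dots\}$. -}

module Defs where

open import Data.Nat using (ℕ; zero; suc; _+_; _*_; pred)
open import Data.List using (List; []; _∷_; map; replicate; _++_)

-- Polynomials with natural-number coefficients, as coefficient lists
-- (constant term first).
Poly : Set
Poly = List ℕ

addP : Poly → Poly → Poly
addP [] q = q
addP p [] = p
addP (a ∷ p) (b ∷ q) = (a + b) ∷ addP p q

mulP : Poly → Poly → Poly
mulP [] q = []
mulP (a ∷ p) q = addP (map (a *_) q) (0 ∷ mulP p q)

oneP : Poly
oneP = 1 ∷ []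

powP : Poly → ℕ → Poly
powP p zero = oneP
powP p (suc m) = mulP p (powP p m)

coeff : Poly → ℕ → ℕ
coeff [] n = 0
coeff (a ∷ p) zero = a
coeff (a ∷ p) (suc n) = coeff p n

-- 1 + x^k, for k ≥ 1
onePlusXPow : ℕ → Poly
onePlusXPow k = 1 ∷ (replicate (pred k) 0 ++ (1 ∷ []))

factor : ℕ → Poly
factor n = mulP (powP (onePlusXPow n) 4)
                (mulP (powP (onePlusXPow (2 * n)) 2) (powP (onePlusXPow (4 * n)) 4))

partialProd : ℕ → Poly
partialProd zero = oneP
partialProd (suc N) = mulP (factor (suc N)) (partialProd N)

-- Factors with index
-- k > n are ≡ 1 mod x^{n+1}, so the coefficient of x^n of the infinite
-- product equals that of the partial product up to index n.
α : ℕ → ℕ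
α n = coeff (partialProd n) n

{-# OPTIONS --safe #-}
module Submission where

-- With natural-number coefficients, a coefficient of a product is positive as soon as
-- one term of its convolution sum is.  Every factor has constant term 1 and the n-th
-- factor contains x^n, so x^n from the n-th factor times the constant terms of the
-- others is a positive contribution to α(n).

open import Defs
open import Data.Nat using (ℕ; zero; suc; _+_; _*_; _<_)
open import Data.Nat.Properties
  using (+-identityʳ; *-zeroʳ; *-mono-<; m≤m+n; m≤n+m; <-≤-trans; 0<1+n)
open import Data.List using ([]; _∷_; map; replicate; _++_)
open import Relation.Binary.PropositionalEquality using (_≡_; refl; sym; subst)

coeff-addP : ∀ p q i → coeff (addP p q) i ≡ coeff p i + coeff q i
coeff-addP []      q       i       = refl
coeff-addP (a ∷ p) []      zero    = sym (+-identityʳ a)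
coeff-addP (a ∷ p) []      (suc i) = sym (+-identityʳ _)
coeff-addP (a ∷ p) (b ∷ q) zero    = refl
coeff-addP (a ∷ p) (b ∷ q) (suc i) = coeff-addP p q i

coeff-map-* : ∀ a q i → coeff (map (a *_) q) i ≡ a * coeff q i
coeff-map-* a []      i       = sym (*-zeroʳ a)
coeff-map-* a (b ∷ q) zero    = refl
coeff-map-* a (b ∷ q) (suc i) = coeff-map-* a q i

coeff-mulP-pos : ∀ p q i j → 0 < coeff p i → 0 < coeff q j → 0 < coeff (mulP p q) (i + j)
coeff-mulP-pos (a ∷ p) q zero j pᵢ>0 q>0
  rewrite coeff-addP (map (a *_) q) (0 ∷ mulP p q) j | coeff-map-* a q j =
  <-≤-trans (*-mono-< pᵢ>0 q>0) (m≤m+n _ _)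
coeff-mulP-pos (a ∷ p) q (suc i) j pᵢ>0 q>0
  rewrite coeff-addP (map (a *_) q) (0 ∷ mulP p q) (suc (i + j)) =
  <-≤-trans (coeff-mulP-pos p q i j pᵢ>0 q>0) (m≤n+m _ _)

coeff-mulP-posˡ : ∀ p q i → 0 < coeff p i → 0 < coeff q 0 → 0 < coeff (mulP p q) i
coeff-mulP-posˡ p q i pᵢ>0 q₀>0 =
  subst (λ k → 0 < coeff (mulP p q) k) (+-identityʳ i) (coeff-mulP-pos p q i 0 pᵢ>0 q₀>0)

coeff-powP-pos₀ : ∀ p m → 0 < coeff p 0 → 0 < coeff (powP p m) 0
coeff-powP-pos₀ p zero    p₀>0 = 0<1+n
coeff-powP-pos₀ p (suc m) p₀>0 = coeff-mulP-posˡ p (powP p m) 0 p₀>0 (coeff-powP-pos₀ p m p₀>0)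

coeff-powP-posˡ : ∀ p m i → 0 < coeff p i → 0 < coeff p 0 → 0 < coeff (powP p (suc m)) i
coeff-powP-posˡ p m i pᵢ>0 p₀>0 = coeff-mulP-posˡ p (powP p m) i pᵢ>0 (coeff-powP-pos₀ p m p₀>0)

coeff-onePlusXPow-self : ∀ k → coeff (onePlusXPow (suc k)) (suc k) ≡ 1
coeff-onePlusXPow-self k = go k
  where
  go : ∀ k → coeff (replicate k 0 ++ (1 ∷ [])) k ≡ 1
  go zero    = refl
  go (suc k) = go k

coeff-onePlusXPow-pos₀ : ∀ k → 0 < coeff (onePlusXPow k) 0
coeff-onePlusXPow-pos₀ k = 0<1+n

coeff-powP-onePlusXPow-pos₀ : ∀ k m → 0 < coeff (powP (onePlusXPow k) m) 0
coeff-powP-onePlusXPow-pos₀ k m = coeff-powP-pos₀ (onePlusXPow k) m (coeff-onePlusXPow-pos₀ k)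

factorTail : ℕ → Poly
factorTail n = mulP (powP (onePlusXPow (2 * n)) 2) (powP (onePlusXPow (4 * n)) 4)

coeff-factorTail-pos₀ : ∀ n → 0 < coeff (factorTail n) 0
coeff-factorTail-pos₀ n =
  coeff-mulP-posˡ (powP (onePlusXPow (2 * n)) 2) (powP (onePlusXPow (4 * n)) 4) 0
    (coeff-powP-onePlusXPow-pos₀ (2 * n) 2) (coeff-powP-onePlusXPow-pos₀ (4 * n) 4)

coeff-factor-pos₀ : ∀ n → 0 < coeff (factor n) 0
coeff-factor-pos₀ n =
  coeff-mulP-posˡ (powP (onePlusXPow n) 4) (factorTail n) 0
    (coeff-powP-onePlusXPow-pos₀ n 4) (coeff-factorTail-pos₀ n)

coeff-factor-pos-self : ∀ k → 0 < coeff (factor (suc k)) (suc k)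
coeff-factor-pos-self k =
  coeff-mulP-posˡ (powP (onePlusXPow (suc k)) 4) (factorTail (suc k)) (suc k)
    (coeff-powP-posˡ (onePlusXPow (suc k)) 3 (suc k) xᵏ>0 (coeff-onePlusXPow-pos₀ (suc k)))
    (coeff-factorTail-pos₀ (suc k))
  where
  xᵏ>0 : 0 < coeff (onePlusXPow (suc k)) (suc k)
  xᵏ>0 = subst (0 <_) (sym (coeff-onePlusXPow-self k)) 0<1+n

coeff-partialProd-pos₀ : ∀ N → 0 < coeff (partialProd N) 0
coeff-partialProd-pos₀ zero    = 0<1+n
coeff-partialProd-pos₀ (suc N) =
  coeff-mulP-posˡ (factor (suc N)) (partialProd N) 0 (coeff-factor-pos₀ (suc N)) (coeff-partialProd-pos₀ N)

theorem5p3 : (n : ℕ) → 0 < α n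
theorem5p3 zero    = 0<1+n
theorem5p3 (suc k) =
  coeff-mulP-posˡ (factor (suc k)) (partialProd k) (suc k)
    (coeff-factor-pos-self k) (coeff-partialProd-pos₀ k)
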